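{- Let $\psi$ be a propositional formula (built with $\land,\lor$ from polynomial inequations $q_1<q_2$, $q_1,q_2\in\mathbb{Z}[x_1,\ldots,x_d]$) and let $npe=\sum_{(p,a,b)\in\Lambda}p\cdot n^a\cdot b^n$, where $\Lambda$ is a finite set of triples $(p,a,b)$ with $p=c\cdot x_1^{e_1}\cdots x_d^{e_d}$ a monomial with coefficient $c\in\mathbb{Q}$, $a\in\mathbb{N}$, $b\in\mathbb{N}_{\ge1}$ (several triples may share the same $(a,b)$). Let $\Delta,\Gamma\subseteq\Lambda$ be disjoint sets such that $\models\psi\to(p>0)$ for all $(p,a,b)\in\Delta$ and $\models\psi\to(p\le0)$ for all $(p,a,b)\in\Gamma$. For each $(p,a,b)\in\Delta\cup\Gamma$ let $i_{(p,a,b)},j_{(p,a,b)}\in\mathbb{N}$ be such that $(j_{(p,a,b)},i_{(p,a,b)})>_{\mathrm{lex}}(b,a)$ if $(p,a,b)\in\Delta$ and $(b,a)>_{\mathrm{lex}}(j_{(p,a,b)},i_{(p,a,b)})$ if $(p,a,b)\in\Gamma$. Let $$\overline{npe}=\sum_{(p,a,b)\in\Delta\cup\Gamma}p\cdot n^{i_{(p,a,b)}}\cdot j_{(p,a,b)}^n+\sum_{(p,a,b)\in\Lambda\setminus(\Delta\cup\Gamma)}p\cdot n^a\cdot b^n$$ and let $D$ be the maximum (with $\max\emptyset=0$) of the set consisting of the $1$-monotonicity thresholds of $(j_{(p,a,b)},i_{(p,a,b)})$ and $(b,a)$ for all $(p,a,b)\in\Delta$, together with the $1$-monotonicity thresholds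 of $(b,a)$ and $(j_{(p,a,b)},i_{(p,a,b)})$ for all $(p,a,b)\in\Gamma$. Then for all $\vec e\in\mathbb{Z}^d$ such that $\sigma_{\vec e}(\psi)$ holds and all integers $n\ge D$, we have $\sigma_{\vec e}(\overline{npe})\ge\sigma_{\vec e}(npe)$.
   Context: $(b_1,a_1)>_{\mathrm{lex}}(b_2,a_2)$ means $b_1>b_2$, or $b_1=b_2$ and $a_1>a_2$. For $(b_1,a_1),(b_2,a_2)\in\mathbb{N}^2$ with $(b_1,a_1)>_{\mathrm{lex}}(b_2,a_2)$ and $k\in\mathbb{N}_{\ge1}$, the $k$-monotonicity threshold of $(b_1,a_1)$ and $(b_2,a_2)$ is the smallest $n_0\in\mathbb{N}$ such that $n^{a_1}b_1^n>k\cdot n^{a_2}b_2^n$ for all $n\ge n_0$ (with $0^0=1$). For $\vec e=(e_1,\ldots,e_d)\in\mathbb{Z}^d$, $\sigma_{\vec e}$ is the assignment $x_i\mapsto e_i$; expressions in the variable $n$ are evaluated under $\sigma_{\vec e}$ for the given value of $n$. -}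

module Defs where

open import Data.Nat as ℕ using (ℕ; zero; suc; _⊔_)
open import Data.Integer as ℤ using (ℤ; +_)
open import Data.Rational as ℚ using (ℚ; 0ℚ)
open import Data.Fin using (Fin; zero; suc)
open import Data.Vec using (Vec; lookup)
open import Data.Bool using (Bool; true; false; if_then_else_)
open import Data.Product using (_×_)
open import Data.Sum using (_⊎_)

data Poly (d : ℕ) : Set where
  con : ℤ → Poly d
  var : Fin d → Poly d
  _⊕_ : Poly d → Poly d → Poly d
  _⊗_ : Poly d → Poly d → Poly d
  ⊖_  : Poly d → Poly d

evalP : ∀ {d} → Vec ℤ d → Poly d → ℤ
evalP e (con c) = c
evalP e (var i) = lookup e i
evalP e (p ⊕ q) = evalP e p ℤ.+ evalP e q
evalP e (p ⊗ q) = evalP e p ℤ.* evalP e q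
evalP e (⊖ p)   = ℤ.- evalP e p

data Formula (d : ℕ) : Set where
  _≺_  : Poly d → Poly d → Formula d
  _∧'_ : Formula d → Formula d → Formula d
  _∨'_ : Formula d → Formula d → Formula d

Holds : ∀ {d} → Vec ℤ d → Formula d → Set
Holds e (p ≺ q)  = evalP e p ℤ.< evalP e q
Holds e (φ ∧' χ) = Holds e φ × Holds e χ
Holds e (φ ∨' χ) = Holds e φ ⊎ Holds e χ

record Monomial (d : ℕ) : Set where
  constructor mono
  field
    coeff : ℚ
    exps  : Vec ℕ d
open Monomial public

powProd : ∀ {d} → Vec ℤ d → Vec ℕ d → ℤ
powProd {zero}  e k = + 1
powProd {suc d} (x Data.Vec.∷ e) (k Data.Vec.∷ ks) = (x ℤ.^ k) ℤ.* powProd e ks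

evalM : ∀ {d} → Vec ℤ d → Monomial d → ℚ
evalM e p = coeff p ℚ.* (powProd e (exps p) ℚ./ 1)

evalTerm : ∀ {d} → Vec ℤ d → ℕ → Monomial d → ℕ → ℕ → ℚ
evalTerm e n p a b = evalM e p ℚ.* (+ (n ℕ.^ a ℕ.* b ℕ.^ n) ℚ./ 1)

ValidPos : ∀ {d} → Formula d → Monomial d → Set
ValidPos ψ p = ∀ e → Holds e ψ → 0ℚ ℚ.< evalM e p

ValidNonPos : ∀ {d} → Formula d → Monomial d → Set
ValidNonPos ψ p = ∀ e → Holds e ψ → evalM e p ℚ.≤ 0ℚ

sumℚ : ∀ {m} → (Fin m → ℚ) → ℚ
sumℚ {zero}  f = 0ℚ
sumℚ {suc m} f = f zero ℚ.+ sumℚ (λ k → f (suc k))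

maxℕ : ∀ {m} → (Fin m → ℕ) → ℕ
maxℕ {zero}  f = 0
maxℕ {suc m} f = f zero ⊔ maxℕ (λ k → f (suc k))

_>lex_ : ℕ × ℕ → ℕ × ℕ → Set
(b₁ Data.Product., a₁) >lex (b₂ Data.Product., a₂) =
  (b₂ ℕ.< b₁) ⊎ ((b₁ ≡ b₂) × (a₂ ℕ.< a₁))
  where open import Relation.Binary.PropositionalEquality using (_≡_)

MonoHolds : ℕ → ℕ × ℕ → ℕ × ℕ → ℕ → Set
MonoHolds k (b₁ Data.Product., a₁) (b₂ Data.Product., a₂) n =
  k ℕ.* (n ℕ.^ a₂ ℕ.* b₂ ℕ.^ n) ℕ.< n ℕ.^ a₁ ℕ.* b₁ ℕ.^ n

IsMonoThreshold : ℕ → ℕ × ℕ → ℕ × ℕ → ℕ → Set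
IsMonoThreshold k x y n₀ =
  (∀ n → n₀ ℕ.≤ n → MonoHolds k x y n) ×
  (∀ m → (∀ n → m ℕ.≤ n → MonoHolds k x y n) → n₀ ℕ.≤ m)

open import Data.Fin.Subset using (Subset; _∪_; inside; outside)

isIn : ∀ {m} → Fin m → Subset m → Bool
isIn k S with lookup S k
... | inside  = true
... | outside = false

-- σ_e(npe) with Λ = { (p k, a k, b k) | k : Fin m }
npe : ∀ {d m} → (Fin m → Monomial d) → (Fin m → ℕ) → (Fin m → ℕ) →
      Vec ℤ d → ℕ → ℚ
npe p a b e n = sumℚ (λ k → evalTerm e n (p k) (a k) (b k))

npeBar : ∀ {d m} → (Fin m → Monomial d) → (Fin m → ℕ) → (Fin m → ℕ) →
         Subset m → Subset m → (Fin m → ℕ) → (Fin m → ℕ) →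
         Vec ℤ d → ℕ → ℚ
npeBar p a b Δ Γ i j e n = sumℚ (λ k →
  if isIn k (Δ ∪ Γ) then evalTerm e n (p k) (i k) (j k)
                    else evalTerm e n (p k) (a k) (b k))

maxOver : ∀ {m} → Subset m → (Fin m → ℕ) → ℕ
maxOver S t = maxℕ (λ k → if isIn k S then t k else 0)

-- The two sums are compared term by term. Outside Δ ∪ Γ the terms coincide. For k ∈ Δ ∪ Γ we
-- have t k ≤ D ≤ n, so by the threshold property the weight n^i j^n of the replacement term is
-- at least n^a b^n when k ∈ Δ and at most it when k ∈ Γ; multiplying by σ_e(p), which ψ forces
-- to be positive on Δ and nonpositive on Γ, the replacement term is never smaller.
module Submission where

open import Defs
open import Data.Nat as ℕ using (ℕ; _≤_)
import Data.Nat.Properties as ℕₚ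
open import Data.Nat.Divisibility using (∣1⇒≡1)
open import Data.Integer as ℤ using (ℤ; +_; +≤+)
import Data.Integer.Properties as ℤₚ
open import Data.Rational as ℚ using (ℚ; 0ℚ; mkℚ; *≤*)
import Data.Rational.Properties as ℚₚ
open import Data.Fin using (Fin; zero; suc)
open import Data.Fin.Subset using (Subset; _∈_; _∪_; inside; outside)
open import Data.Fin.Subset.Properties using (x∈p∪q⁻)
open import Data.Vec using (Vec; lookup)
open import Data.Vec.Properties using (lookup⇒[]=)
open import Data.Product using (_,_; proj₁)
open import Data.Sum using (inj₁; inj₂)
open import Data.Bool using (if_then_else_)
open import Data.Empty using (⊥)
open import Function.Definitions using (Injective)
open import Relation.Binary.PropositionalEquality using (_≡_; refl; subst₂; sym)

+/1≡mkℚ : ∀ x → + x ℚ./ 1 ≡ mkℚ (+ x) 0 (λ (_ , d∣1) → ∣1⇒≡1 d∣1)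
+/1≡mkℚ x = ℚₚ.normalize-coprime _

+/1-mono-≤ : ∀ {x y} → x ≤ y → + x ℚ./ 1 ℚ.≤ + y ℚ./ 1
+/1-mono-≤ {x} {y} x≤y rewrite +/1≡mkℚ x | +/1≡mkℚ y =
  *≤* (subst₂ ℤ._≤_ (sym (ℤₚ.*-identityʳ (+ x))) (sym (ℤₚ.*-identityʳ (+ y))) (+≤+ x≤y))

sumℚ-mono-≤ : ∀ {m} {f g : Fin m → ℚ} → (∀ k → f k ℚ.≤ g k) → sumℚ f ℚ.≤ sumℚ g
sumℚ-mono-≤ {ℕ.zero}  f≤g = ℚₚ.≤-refl
sumℚ-mono-≤ {ℕ.suc m} f≤g = ℚₚ.+-mono-≤ (f≤g zero) (sumℚ-mono-≤ (λ k → f≤g (suc k)))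

maxℕ-lub⁻ : ∀ {m} (f : Fin m → ℕ) {n} → maxℕ f ≤ n → ∀ k → f k ≤ n
maxℕ-lub⁻ f f≤n zero    = ℕₚ.m⊔n≤o⇒m≤o _ _ f≤n
maxℕ-lub⁻ f f≤n (suc k) = maxℕ-lub⁻ (λ k → f (suc k)) (ℕₚ.m⊔n≤o⇒n≤o (f zero) _ f≤n) k

maxOver-lub⁻ : ∀ {m} (S : Subset m) (t : Fin m → ℕ) {n} →
               maxOver S t ≤ n → ∀ {k} → lookup S k ≡ inside → t k ≤ n
maxOver-lub⁻ S t D≤n {k} k∈S with maxℕ-lub⁻ _ D≤n k
... | tk≤n rewrite k∈S = tk≤n

MonoHolds-1⇒≤ : ∀ b₁ a₁ b₂ a₂ n → MonoHolds 1 (b₁ , a₁) (b₂ , a₂) n →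
                n ℕ.^ a₂ ℕ.* b₂ ℕ.^ n ≤ n ℕ.^ a₁ ℕ.* b₁ ℕ.^ n
MonoHolds-1⇒≤ b₁ a₁ b₂ a₂ n lt =
  ℕₚ.<⇒≤ (subst₂ ℕ._<_ (ℕₚ.*-identityˡ _) refl lt)

evalTerm-mono-pos : ∀ {d} e n (p : Monomial d) a b i j → 0ℚ ℚ.< evalM e p →
                    MonoHolds 1 (j , i) (b , a) n →
                    evalTerm e n p a b ℚ.≤ evalTerm e n p i j
evalTerm-mono-pos e n p a b i j p>0 w≤w =
  ℚₚ.*-monoˡ-≤-nonNeg (evalM e p) {{ℚₚ.pos⇒nonNeg (evalM e p) {{ℚ.positive p>0}}}}
    (+/1-mono-≤ (MonoHolds-1⇒≤ j i b a n w≤w))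

evalTerm-mono-nonPos : ∀ {d} e n (p : Monomial d) a b i j → evalM e p ℚ.≤ 0ℚ →
                       MonoHolds 1 (b , a) (j , i) n →
                       evalTerm e n p a b ℚ.≤ evalTerm e n p i j
evalTerm-mono-nonPos e n p a b i j p≤0 w≥w =
  ℚₚ.*-monoˡ-≤-nonPos (evalM e p) {{ℚ.nonPositive p≤0}}
    (+/1-mono-≤ (MonoHolds-1⇒≤ b a j i n w≥w))

lemma26 : ∀ {d m : ℕ} (ψ : Formula d)
    (p : Fin m → Monomial d) (a b : Fin m → ℕ) →
    Injective _≡_ _≡_ (λ k → (p k , a k , b k)) →
    (∀ k → 1 ≤ b k) →
    (Δ Γ : Subset m) →
    (∀ k → k ∈ Δ → k ∈ Γ → ⊥) →
    (∀ k → k ∈ Δ → ValidPos ψ (p k)) →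
    (∀ k → k ∈ Γ → ValidNonPos ψ (p k)) →
    (i j : Fin m → ℕ) →
    (∀ k → k ∈ Δ → (j k , i k) >lex (b k , a k)) →
    (∀ k → k ∈ Γ → (b k , a k) >lex (j k , i k)) →
    (t : Fin m → ℕ) →
    (∀ k → k ∈ Δ → IsMonoThreshold 1 (j k , i k) (b k , a k) (t k)) →
    (∀ k → k ∈ Γ → IsMonoThreshold 1 (b k , a k) (j k , i k) (t k)) →
    ∀ (e : Vec ℤ d) → Holds e ψ →
    ∀ (n : ℕ) → maxOver (Δ ∪ Γ) t ≤ n →
    npe p a b e n ℚ.≤ npeBar p a b Δ Γ i j e n
lemma26 ψ p a b _ _ Δ Γ _ posΔ nonPosΓ i j _ _ t thΔ thΓ e ψ-holds n D≤n =
  sumℚ-mono-≤ term≤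
  where
  t≤n : ∀ {k} → lookup (Δ ∪ Γ) k ≡ inside → t k ≤ n
  t≤n = maxOver-lub⁻ (Δ ∪ Γ) t D≤n

  term≤ : ∀ k → evalTerm e n (p k) (a k) (b k) ℚ.≤
                (if isIn k (Δ ∪ Γ) then evalTerm e n (p k) (i k) (j k)
                                   else evalTerm e n (p k) (a k) (b k))
  term≤ k with lookup (Δ ∪ Γ) k in k∈Δ∪Γ
  ... | outside = ℚₚ.≤-refl
  ... | inside with x∈p∪q⁻ Δ Γ (lookup⇒[]= k (Δ ∪ Γ) k∈Δ∪Γ)
  ...   | inj₁ k∈Δ = evalTerm-mono-pos e n (p k) (a k) (b k) (i k) (j k)
                       (posΔ k k∈Δ e ψ-holds) (proj₁ (thΔ k k∈Δ) n (t≤n k∈Δ∪Γ))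
  ...   | inj₂ k∈Γ = evalTerm-mono-nonPos e n (p k) (a k) (b k) (i k) (j k)
                       (nonPosΓ k k∈Γ e ψ-holds) (proj₁ (thΓ k k∈Γ) n (t≤n k∈Δ∪Γ))
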